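{- Let $n\ge 3$ and let $U=U(C_n,\{T_{m_1},\dots,T_{m_k}\})$ be the signed unicyclic graph consisting of a signed cycle $C_n$ and $k$ pairwise vertex-disjoint signed trees $T_{m_1},\dots,T_{m_k}$, where the root of each $T_{m_i}$ is joined by an edge to the same fixed vertex $v$ of $C_n$. Then $$\mathrm{per}\, U=\mathrm{per}(C_n)\prod_{i=1}^k\mathrm{per}(T_{m_i})+\mathrm{per}(P_{n-1})\sum_{i=1}^k\Big(\mathrm{per}(\{T_{m_i},v\})\prod_{j=1,\,j\ne i}^k\mathrm{per}(T_{m_j})\Big).$$
   Context: A signed graph has edge weights in $\{1,-1\}$; the permanent of a graph is the permanent of its adjacency matrix. $P_{n-1}$ denotes the signed path $C_n\setminus v$, and $\{T_{m_i},v\}$ denotes the subgraph induced by the vertices of $T_{m_i}$ together with $v$. -}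

module Defs where

open import Data.Nat using (ℕ; zero; suc; _+_; _≤_; _≡ᵇ_)
open import Data.Integer using (ℤ; 0ℤ; 1ℤ; -1ℤ; _*_) renaming (_+_ to _+ℤ_)
open import Data.Fin using (Fin; zero; suc; toℕ; splitAt; _↑ˡ_; _≟_)
open import Data.Fin.Properties using (all?)
open import Data.List using (List; []; _∷_; [_]; _++_; map; concatMap; foldr; length; filter; allFin; lookup)
open import Data.List.Relation.Unary.Unique.Propositional using (Unique)
open import Data.Sum using (_⊎_; inj₁; inj₂)
open import Data.Product using (_×_)
open import Data.Bool using (Bool; true; false; if_then_else_; _∧_; _∨_)
open import Data.Unit using (⊤)
open import Data.Sign using (Sign)
open import Relation.Nullary using (¬_; Dec; yes; no; ¬?; _→-dec_)
open import Relation.Nullary.Decidable using (⌊_⌋)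
open import Relation.Binary.PropositionalEquality using (_≡_)

Mat : ℕ → Set
Mat n = Fin n → Fin n → ℤ

IsSignedGraph : ∀ {n} → Mat n → Set
IsSignedGraph {n} A =
  (∀ i j → A i j ≡ 0ℤ ⊎ A i j ≡ 1ℤ ⊎ A i j ≡ -1ℤ) ×
  (∀ i j → A i j ≡ A j i) ×
  (∀ i → A i i ≡ 0ℤ)

Adj : ∀ {n} → Mat n → Fin n → Fin n → Set
Adj A i j = ¬ (A i j ≡ 0ℤ)

data Reach {n} (A : Mat n) : Fin n → Fin n → Set where
  here : ∀ {i} → Reach A i i
  step : ∀ {i j l} → Reach A i j → Adj A j l → Reach A i l

Connected : ∀ {n} → Mat n → Set
Connected {n} A = ∀ (i j : Fin n) → Reach A i j

Walk : ∀ {n} → Mat n → List (Fin n) → Set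
Walk A [] = ⊤
Walk A (x ∷ []) = ⊤
Walk A (x ∷ y ∷ r) = Adj A x y × Walk A (y ∷ r)

IsCycle : ∀ {n} → Mat n → Fin n → List (Fin n) → Set
IsCycle A x rest = 2 ≤ length rest × Unique (x ∷ rest) × Walk A (x ∷ rest ++ [ x ])

Acyclic : ∀ {n} → Mat n → Set
Acyclic {n} A = ∀ (x : Fin n) (rest : List (Fin n)) → ¬ IsCycle A x rest

IsSignedTree : ∀ {n} → Mat n → Set
IsSignedTree A = IsSignedGraph A × Connected A × Acyclic A

signℤ : Sign → ℤ
signℤ Sign.+ = 1ℤ
signℤ Sign.- = -1ℤ

sumℤ : List ℤ → ℤ
sumℤ = foldr _+ℤ_ 0ℤ

prodℤ : List ℤ → ℤ
prodℤ = foldr _*_ 1ℤ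

allFuns : ∀ n m → List (Fin n → Fin m)
allFuns zero m = [ (λ ()) ] 
allFuns (suc n) m =
  concatMap (λ f → map (λ x → cons x f) (allFin m)) (allFuns n m)
  where
  cons : Fin m → (Fin n → Fin m) → Fin (suc n) → Fin m
  cons x f zero = x
  cons x f (suc i) = f i

injective? : ∀ {n} (f : Fin n → Fin n) → Dec (∀ i j → f i ≡ f j → i ≡ j)
injective? f = all? (λ i → all? (λ j → (f i ≟ f j) →-dec (i ≟ j)))

-- the permutations of Fin n are exactly the injective maps Fin n → Fin n
permutations : ∀ n → List (Fin n → Fin n)
permutations n = filter injective? (allFuns n n)

per : ∀ {n} → Mat n → ℤ
per {n} A = sumℤ (map (λ σ → prodℤ (map (λ i → A i (σ i)) (allFin n))) (permutations n))

-- The signed cycle C_n on Fin n: edge {i, i+1 mod n} has sign w i.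

next? : (n : ℕ) → Fin n → Fin n → Bool
next? n i j = (suc (toℕ i) ≡ᵇ toℕ j) ∨ ((suc (toℕ i) ≡ᵇ n) ∧ (toℕ j ≡ᵇ 0))

cycleMat : (n : ℕ) → (Fin n → Sign) → Mat n
cycleMat n w i j =
  if next? n i j then signℤ (w i)
  else if next? n j i then signℤ (w j)
  else 0ℤ

deleteVertex : ∀ {n} → Fin n → Mat n → Mat (Data.Nat.pred n)
deleteVertex {suc p} v A i j = A (Data.Fin.punchIn v i) (Data.Fin.punchIn v j)

record PendantTree : Set where
  field
    size   : ℕ
    adj    : Mat size
    isTree : IsSignedTree adj
    root   : Fin size
    link   : Sign      -- sign of the edge joining the root to v

open PendantTree public

glue : ∀ {a m} → Mat a → Fin a → Mat m → Fin m → ℤ → Mat (a + m)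
glue {a} {m} G v T r s i j with splitAt a i | splitAt a j
... | inj₁ x | inj₁ y = G x y
... | inj₂ x | inj₂ y = T x y
... | inj₁ x | inj₂ y = if ⌊ x ≟ v ⌋ ∧ ⌊ y ≟ r ⌋ then s else 0ℤ
... | inj₂ x | inj₁ y = if ⌊ y ≟ v ⌋ ∧ ⌊ x ≟ r ⌋ then s else 0ℤ

glueT : ∀ {a} → Mat a → Fin a → (t : PendantTree) → Mat (a + size t)
glueT G v t = glue G v (adj t) (root t) (signℤ (link t))

sizeAll : ℕ → List PendantTree → ℕ
sizeAll a [] = a
sizeAll a (t ∷ ts) = sizeAll (a + size t) ts

glueAll : ∀ {a} → Mat a → Fin a → (ts : List PendantTree) → Mat (sizeAll a ts)
glueAll G v [] = G
glueAll {a} G v (t ∷ ts) = glueAll (glueT G v t) (v ↑ˡ size t) ts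

unicyclic : (n : ℕ) → (Fin n → Sign) → Fin n → (ts : List PendantTree) → Mat (sizeAll n ts)
unicyclic n w v ts = glueAll (cycleMat n w) v ts

-- {T, v}: subgraph induced by T together with v (a single vertex joined to the root)
withV : (t : PendantTree) → Mat (1 + size t)
withV t = glueT (λ _ _ → 0ℤ) zero t

mixedSum : List PendantTree → ℤ
mixedSum ts =
  sumℤ (map (λ i → per (withV (lookup ts i)) *
                   prodℤ (map (λ j → per (adj (lookup ts j)))
                              (filter (λ j → ¬? (j ≟ i)) (allFin (length ts)))))
            (allFin (length ts)))

-- The formula holds with an arbitrary matrix G in place of the cycle, and rests on a gluing
-- identity: if T is joined to G by a single entry s between v and the root r (in both
-- directions), then per = per G · per T + s² · per (G ∖ v) · per (T ∖ r). Expanding along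
-- the row of v isolates the entry s; what remains is block triangular, and in the minor of s
-- the row of r, expanded in turn, keeps only its entry s, because the rest contains a zero
-- block that no permutation avoids. With s = ±1, per {T, v} = per (T ∖ r) by the same
-- identity, and attaching the trees one at a time gives the formula by induction.

module Submission where

open import Defs
open import Data.Nat using (ℕ; _≤_)
open import Data.Integer using (_+_; _*_)
open import Data.Fin using (Fin)
open import Data.List using (List; map)
open import Data.Sign using (Sign)
open import Relation.Binary.PropositionalEquality using (_≡_)

import Algebra.Properties.CommutativeMonoid.Sum as Sum
import Algebra.Properties.Semiring.Sum as SemiringSum
open import Data.Bool using (Bool; true; false; if_then_else_; _∧_)
open import Data.Empty using (⊥-elim)
open import Data.Fin using (zero; suc; punchIn; punchOut; toℕ; _≟_; _↑ˡ_; _↑ʳ_; cast)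
open import Data.Fin.Properties
  using (punchIn-injective; punchInᵢ≢i; punchIn-punchOut; splitAt-↑ˡ; splitAt-↑ʳ; toℕ-↑ˡ; toℕ-↑ʳ;
         toℕ-injective; toℕ<n; ↑ˡ-injective; cast-is-id; toℕ-cast; suc-injective;
         splitAt-<; splitAt-≥; splitAt⁻¹-↑ˡ; splitAt⁻¹-↑ʳ)
open import Data.Integer using (ℤ; 0ℤ; 1ℤ; -1ℤ)
open import Data.Integer.Properties
  using (+-identityˡ; +-identityʳ; +-assoc; +-comm; *-identityˡ; *-zeroˡ; *-zeroʳ; *-assoc;
         +-0-commutativeMonoid; *-1-commutativeMonoid; +-*-semiring)
open import Data.Integer.Tactic.RingSolver using (solve-∀)
open import Data.List using ([]; _∷_; _++_; concatMap; filter; allFin; tabulate; length; lookup)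
open import Data.List.Properties using (map-cong; map-∘; filter-all; map-++; map-tabulate)
open import Data.List.Relation.Unary.All.Properties using (tabulate⁺)
open import Data.Nat as ℕ using (zero; suc)
import Data.Nat.Properties as NP
open import Data.Product using (Σ; _×_; _,_; proj₁; proj₂)
open import Data.Sum using (_⊎_; inj₁; inj₂)
open import Data.Vec.Functional using (insertAt)
open import Data.Vec.Functional.Properties using (insertAt-lookup; insertAt-punchIn)
open import Function using (_∘_; mk⇔)
open import Relation.Nullary using (¬_; Dec; does; yes; no; ¬?)
open import Relation.Nullary.Decidable using (⌊_⌋; does-⇔; isYes≗does; dec-false)
open import Relation.Binary.PropositionalEquality
  using (refl; sym; trans; cong; cong₂; subst; subst₂; _≢_; _≗_; module ≡-Reasoning)

open Sum +-0-commutativeMonoid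
  using (sum; sum-syntax; sum-cong-≗; sum-remove; sum-replicate-zero; ∑-distrib-+; ∑-comm)
open SemiringSum +-*-semiring using (*-distribˡ-sum; *-distribʳ-sum)
module Product = Sum *-1-commutativeMonoid

∏ : ∀ {n} → (Fin n → ℤ) → ℤ
∏ = Product.sum

∑-zero : ∀ {n} (f : Fin n → ℤ) → (∀ i → f i ≡ 0ℤ) → sum f ≡ 0ℤ
∑-zero {n} f f≡0 = trans (sum-cong-≗ {x = f} {y = λ _ → 0ℤ} f≡0) (sum-replicate-zero n)

∑-↑ : ∀ a b (f : Fin (a ℕ.+ b) → ℤ) → sum f ≡ sum (λ x → f (x ↑ˡ b)) + sum (λ y → f (a ↑ʳ y))
∑-↑ zero    b f = sym (+-identityˡ _)
∑-↑ (suc a) b f = trans (cong (f zero +_) (∑-↑ a b (f ∘ suc))) (sym (+-assoc (f zero) _ _))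

sumℤ-tabulate : ∀ {n} (f : Fin n → ℤ) → sumℤ (tabulate f) ≡ sum f
sumℤ-tabulate {zero}  f = refl
sumℤ-tabulate {suc n} f = cong (f zero +_) (sumℤ-tabulate (f ∘ suc))

prodℤ-tabulate : ∀ {n} (f : Fin n → ℤ) → prodℤ (tabulate f) ≡ ∏ f
prodℤ-tabulate {zero}  f = refl
prodℤ-tabulate {suc n} f = cong (f zero *_) (prodℤ-tabulate (f ∘ suc))

sumℤ-allFin : ∀ {n} (f : Fin n → ℤ) → sumℤ (map f (allFin n)) ≡ sum f
sumℤ-allFin {n} f = trans (cong sumℤ (map-tabulate (λ i → i) f)) (sumℤ-tabulate f)

prodℤ-allFin : ∀ {n} (f : Fin n → ℤ) → prodℤ (map f (allFin n)) ≡ ∏ f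
prodℤ-allFin {n} f = trans (cong prodℤ (map-tabulate (λ i → i) f)) (prodℤ-tabulate f)

sumℤ-++ : (xs ys : List ℤ) → sumℤ (xs ++ ys) ≡ sumℤ xs + sumℤ ys
sumℤ-++ []       ys = sym (+-identityˡ _)
sumℤ-++ (x ∷ xs) ys = trans (cong (x +_) (sumℤ-++ xs ys)) (sym (+-assoc x _ _))

sumℤ-concatMap : ∀ {A B : Set} (g : A → List B) (F : B → ℤ) (xs : List A) →
  sumℤ (map F (concatMap g xs)) ≡ sumℤ (map (λ a → sumℤ (map F (g a))) xs)
sumℤ-concatMap g F []       = refl
sumℤ-concatMap g F (a ∷ xs) = begin
  sumℤ (map F (g a ++ concatMap g xs))                 ≡⟨ cong sumℤ (map-++ F (g a) (concatMap g xs)) ⟩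
  sumℤ (map F (g a) ++ map F (concatMap g xs))         ≡⟨ sumℤ-++ (map F (g a)) _ ⟩
  sumℤ (map F (g a)) + sumℤ (map F (concatMap g xs))   ≡⟨ cong (sumℤ (map F (g a)) +_) (sumℤ-concatMap g F xs) ⟩
  sumℤ (map F (g a)) + sumℤ (map (λ a → sumℤ (map F (g a))) xs) ∎
  where open ≡-Reasoning

indicator : Bool → ℤ
indicator true  = 1ℤ
indicator false = 0ℤ

sumℤ-filter : ∀ {A : Set} {P : A → Set} (P? : ∀ x → Dec (P x)) (F : A → ℤ) (xs : List A) →
  sumℤ (map F (filter P? xs)) ≡ sumℤ (map (λ a → indicator ⌊ P? a ⌋ * F a) xs)
sumℤ-filter P? F []       = refl
sumℤ-filter P? F (x ∷ xs) with P? x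
... | yes _ = cong₂ _+_ (sym (*-identityˡ (F x))) (sumℤ-filter P? F xs)
... | no _  = trans (sumℤ-filter P? F xs) (sym (+-identityˡ _))

insertAt-cong : ∀ {k} {A : Set} (v : Fin (suc k)) (x : A) {f g : Fin k → A} → f ≗ g → insertAt f v x ≗ insertAt g v x
insertAt-cong         zero    x f≗g zero    = refl
insertAt-cong         zero    x f≗g (suc j) = f≗g j
insertAt-cong {suc k} (suc v) x f≗g zero    = f≗g zero
insertAt-cong {suc k} (suc v) x f≗g (suc j) = insertAt-cong v x (f≗g ∘ suc) j

≡-or-punchIn : ∀ {n} (v a : Fin (suc n)) → a ≡ v ⊎ Σ (Fin n) (λ i → punchIn v i ≡ a)
≡-or-punchIn v a with v ≟ a
... | yes v≡a = inj₁ (sym v≡a)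
... | no  v≢a = inj₂ (punchOut v≢a , punchIn-punchOut v≢a)

punchIn-↑ˡ : ∀ {a} q (y : Fin (suc a)) (j : Fin a) → punchIn (y ↑ˡ q) (j ↑ˡ q) ≡ punchIn y j ↑ˡ q
punchIn-↑ˡ q zero    j       = refl
punchIn-↑ˡ q (suc y) zero    = refl
punchIn-↑ˡ q (suc y) (suc j) = cong suc (punchIn-↑ˡ q y j)

punchIn-↑ʳ : ∀ {a} q (y : Fin (suc a)) (z : Fin q) → punchIn (y ↑ˡ q) (a ↑ʳ z) ≡ suc a ↑ʳ z
punchIn-↑ʳ         q zero    z = refl
punchIn-↑ʳ {suc a} q (suc y) z = cong suc (punchIn-↑ʳ q y z)

↑ˡ≢↑ʳ : ∀ {a m} (x : Fin a) (y : Fin m) → x ↑ˡ m ≢ a ↑ʳ y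
↑ˡ≢↑ʳ zero    y ()
↑ˡ≢↑ʳ (suc x) y x↑≡y↑ = ↑ˡ≢↑ʳ x y (suc-injective x↑≡y↑)

cast-injective : ∀ {n n′} (e : n ≡ n′) {i j : Fin n} → cast e i ≡ cast e j → i ≡ j
cast-injective e {i} {j} eq = toℕ-injective (trans (sym (toℕ-cast e i)) (trans (cong toℕ eq) (toℕ-cast e j)))

toℕ-punchIn≤ : ∀ {n} (x : Fin (suc n)) j → toℕ (punchIn x j) ℕ.≤ suc (toℕ j)
toℕ-punchIn≤ zero    j       = NP.≤-refl
toℕ-punchIn≤ (suc x) zero    = ℕ.z≤n
toℕ-punchIn≤ (suc x) (suc j) = ℕ.s≤s (toℕ-punchIn≤ x j)

toℕ-punchIn-< : ∀ {n} (i : Fin (suc n)) (j : Fin n) → toℕ j ℕ.< toℕ i → toℕ (punchIn i j) ≡ toℕ j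
toℕ-punchIn-< (suc i) zero    _            = refl
toℕ-punchIn-< (suc i) (suc j) (ℕ.s≤s j<i) = cong suc (toℕ-punchIn-< i j j<i)

toℕ-punchIn-≥ : ∀ {n} (i : Fin (suc n)) (j : Fin n) → toℕ i ℕ.≤ toℕ j → toℕ (punchIn i j) ≡ suc (toℕ j)
toℕ-punchIn-≥ zero    j       _            = refl
toℕ-punchIn-≥ (suc i) (suc j) (ℕ.s≤s i≤j) = cong suc (toℕ-punchIn-≥ i j i≤j)

toℕ-punchIn-shift : ∀ k {n n′} (i : Fin (suc n)) (j : Fin n) (i′ : Fin (suc n′)) (j′ : Fin n′) →
  toℕ i′ ≡ k ℕ.+ toℕ i → toℕ j′ ≡ k ℕ.+ toℕ j → toℕ (punchIn i′ j′) ≡ k ℕ.+ toℕ (punchIn i j)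
toℕ-punchIn-shift k i j i′ j′ i′≡ j′≡ with NP.<-≤-connex (toℕ j) (toℕ i)
... | inj₁ j<i = begin
  toℕ (punchIn i′ j′)      ≡⟨ toℕ-punchIn-< i′ j′ (subst₂ ℕ._<_ (sym j′≡) (sym i′≡) (NP.+-monoʳ-< k j<i)) ⟩
  toℕ j′                   ≡⟨ j′≡ ⟩
  k ℕ.+ toℕ j              ≡⟨ cong (k ℕ.+_) (toℕ-punchIn-< i j j<i) ⟨
  k ℕ.+ toℕ (punchIn i j)  ∎
  where open ≡-Reasoning
... | inj₂ i≤j = begin
  toℕ (punchIn i′ j′)      ≡⟨ toℕ-punchIn-≥ i′ j′ (subst₂ ℕ._≤_ (sym i′≡) (sym j′≡) (NP.+-monoʳ-≤ k i≤j)) ⟩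
  suc (toℕ j′)             ≡⟨ cong suc j′≡ ⟩
  suc (k ℕ.+ toℕ j)        ≡⟨ NP.+-suc k (toℕ j) ⟨
  k ℕ.+ suc (toℕ j)        ≡⟨ cong (k ℕ.+_) (toℕ-punchIn-≥ i j i≤j) ⟨
  k ℕ.+ toℕ (punchIn i j)  ∎
  where open ≡-Reasoning

↑ˡ-of-< : ∀ a m (i : Fin (a ℕ.+ m)) → toℕ i ℕ.< a → Σ (Fin a) (λ x → x ↑ˡ m ≡ i)
↑ˡ-of-< a m i i<a = _ , splitAt⁻¹-↑ˡ (splitAt-< a i i<a)

↑ʳ-of-≥ : ∀ a m (i : Fin (a ℕ.+ m)) → a ℕ.≤ toℕ i → Σ (Fin m) (λ y → a ↑ʳ y ≡ i)
↑ʳ-of-≥ a m i a≤i = _ , splitAt⁻¹-↑ʳ (splitAt-≥ a i a≤i)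

-- The permanent as an iterated sum over maps; expansion along a row

∑maps : ∀ k c → ((Fin k → Fin c) → ℤ) → ℤ
∑maps zero    c F = F (λ ())
∑maps (suc k) c F = ∑[ x < c ] ∑maps k c (λ f → F (insertAt f zero x))

Extensional : ∀ {k c} → ((Fin k → Fin c) → ℤ) → Set
Extensional F = ∀ {f g} → f ≗ g → F f ≡ F g

∑maps-cong : ∀ k c (F G : (Fin k → Fin c) → ℤ) → (∀ f → F f ≡ G f) → ∑maps k c F ≡ ∑maps k c G
∑maps-cong zero    c F G F≡G = F≡G _
∑maps-cong (suc k) c F G F≡G =
  sum-cong-≗ (λ x → ∑maps-cong k c (λ f → F (insertAt f zero x)) (λ f → G (insertAt f zero x)) (λ f → F≡G _))

∑maps-distrib-+ : ∀ k c (F G : (Fin k → Fin c) → ℤ) →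
  ∑maps k c (λ f → F f + G f) ≡ ∑maps k c F + ∑maps k c G
∑maps-distrib-+ zero    c F G = refl
∑maps-distrib-+ (suc k) c F G =
  trans (sum-cong-≗ (λ x → ∑maps-distrib-+ k c (F ∘ cons x) (G ∘ cons x)))
        (∑-distrib-+ (λ x → ∑maps k c (F ∘ cons x)) (λ x → ∑maps k c (G ∘ cons x)))
  where
  cons : Fin c → (Fin k → Fin c) → Fin (suc k) → Fin c
  cons x f = insertAt f zero x

∑maps-zero : ∀ k c → ∑maps k c (λ _ → 0ℤ) ≡ 0ℤ
∑maps-zero zero    c = refl
∑maps-zero (suc k) c = ∑-zero {c} (λ _ → ∑maps k c (λ _ → 0ℤ)) (λ _ → ∑maps-zero k c)

∑maps-*ˡ : ∀ k c z (F : (Fin k → Fin c) → ℤ) → ∑maps k c (λ f → z * F f) ≡ z * ∑maps k c F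
∑maps-*ˡ zero    c z F = refl
∑maps-*ˡ (suc k) c z F =
  trans (sum-cong-≗ (λ x → ∑maps-*ˡ k c z (F ∘ cons x)))
        (sym (*-distribˡ-sum z (λ x → ∑maps k c (F ∘ cons x))))
  where
  cons : Fin c → (Fin k → Fin c) → Fin (suc k) → Fin c
  cons x f = insertAt f zero x

∑maps-∑ : ∀ k c {n} (H : Fin n → (Fin k → Fin c) → ℤ) →
  ∑maps k c (λ f → ∑[ x < n ] H x f) ≡ ∑[ x < n ] ∑maps k c (H x)
∑maps-∑ k c {zero}  H = ∑maps-zero k c
∑maps-∑ k c {suc n} H = trans (∑maps-distrib-+ k c _ _) (cong (∑maps k c (H zero) +_) (∑maps-∑ k c (H ∘ suc)))

∑maps-insertAt : ∀ k c (v : Fin (suc k)) (F : (Fin (suc k) → Fin c) → ℤ) → Extensional F →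
  ∑maps (suc k) c F ≡ ∑[ x < c ] ∑maps k c (λ g → F (insertAt g v x))
∑maps-insertAt k       c zero    F ext = refl
∑maps-insertAt (suc k) c (suc v) F ext = begin
  ∑[ y < c ] ∑maps (suc k) c (λ f → F (insertAt f zero y))
    ≡⟨ sum-cong-≗ (λ y → ∑maps-insertAt k c v _ (λ f≗g → ext (insertAt-cong zero y f≗g))) ⟩
  ∑[ y < c ] ∑[ x < c ] ∑maps k c (λ g → F (insertAt (insertAt g v x) zero y))
    ≡⟨ ∑-comm (λ y x → ∑maps k c (λ g → F (insertAt (insertAt g v x) zero y))) ⟩
  ∑[ x < c ] ∑[ y < c ] ∑maps k c (λ g → F (insertAt (insertAt g v x) zero y))
    ≡⟨ sum-cong-≗ (λ x → sum-cong-≗ (λ y → ∑maps-cong k c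
         (λ g → F (insertAt (insertAt g v x) zero y)) (λ g → F (insertAt (insertAt g zero y) (suc v) x))
         (λ g → ext λ { zero → refl ; (suc j) → refl }))) ⟩
  ∑[ x < c ] ∑[ y < c ] ∑maps k c (λ g → F (insertAt (insertAt g zero y) (suc v) x)) ∎
  where open ≡-Reasoning

∑maps-avoid : ∀ k c (x : Fin (suc c)) (F : (Fin k → Fin (suc c)) → ℤ) → Extensional F →
  (∀ g i → g i ≡ x → F g ≡ 0ℤ) → ∑maps k (suc c) F ≡ ∑maps k c (λ g → F (punchIn x ∘ g))
∑maps-avoid zero    c x F ext hits = ext (λ ())
∑maps-avoid (suc k) c x F ext hits = begin
  ∑[ y < suc c ] ∑maps k (suc c) (λ f → F (insertAt f zero y))
    ≡⟨ sum-remove {i = x} (λ y → ∑maps k (suc c) (λ f → F (insertAt f zero y))) ⟩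
  ∑maps k (suc c) (λ f → F (insertAt f zero x)) + ∑[ y < c ] ∑maps k (suc c) (λ f → F (insertAt f zero (punchIn x y)))
    ≡⟨ cong₂ _+_ (trans (∑maps-cong k (suc c) (λ f → F (insertAt f zero x)) (λ _ → 0ℤ) (λ f → hits _ zero refl)) (∑maps-zero k (suc c)))
                 (sum-cong-≗ λ y → ∑maps-avoid k c x _ (λ f≗g → ext (insertAt-cong zero (punchIn x y) f≗g))
                                                        (λ g i gi≡x → hits _ (suc i) gi≡x)) ⟩
  0ℤ + ∑[ y < c ] ∑maps k c (λ g → F (insertAt (punchIn x ∘ g) zero (punchIn x y)))
    ≡⟨ +-identityˡ _ ⟩
  ∑[ y < c ] ∑maps k c (λ g → F (insertAt (punchIn x ∘ g) zero (punchIn x y)))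
    ≡⟨ sum-cong-≗ (λ y → ∑maps-cong k c
         (λ g → F (insertAt (punchIn x ∘ g) zero (punchIn x y))) (λ g → F (punchIn x ∘ insertAt g zero y))
         (λ g → ext λ { zero → refl ; (suc j) → refl })) ⟩
  ∑[ y < c ] ∑maps k c (λ g → F (punchIn x ∘ insertAt g zero y)) ∎
  where open ≡-Reasoning

sumℤ-allFuns : ∀ k c (F : (Fin k → Fin c) → ℤ) → Extensional F → sumℤ (map F (allFuns k c)) ≡ ∑maps k c F
sumℤ-allFuns zero    c F ext = +-identityʳ _
sumℤ-allFuns (suc k) c F ext =
  trans (sumℤ-concatMap _ F (allFuns k c))
  (trans (cong sumℤ (map-cong (λ f → extend f _ (λ x → λ { zero → refl ; (suc i) → refl })) (allFuns k c)))
  (trans (sumℤ-allFuns k c (λ f → ∑[ x < c ] F (insertAt f zero x))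
                           (λ f≗g → sum-cong-≗ λ x → ext (insertAt-cong zero x f≗g)))
         (∑maps-∑ k c (λ x f → F (insertAt f zero x)))))
  where
  extend : ∀ f (g : Fin c → Fin (suc k) → Fin c) → (∀ x → g x ≗ insertAt f zero x) →
           sumℤ (map F (map g (allFin c))) ≡ ∑[ x < c ] F (insertAt f zero x)
  extend f g g≗ = begin
    sumℤ (map F (map g (allFin c)))   ≡⟨ cong sumℤ (sym (map-∘ (allFin c))) ⟩
    sumℤ (map (F ∘ g) (allFin c))     ≡⟨ sumℤ-allFin (F ∘ g) ⟩
    ∑[ x < c ] F (g x)                ≡⟨ sum-cong-≗ (λ x → ext (g≗ x)) ⟩
    ∑[ x < c ] F (insertAt f zero x)  ∎
    where open ≡-Reasoning

⌊⌋-⇔ : ∀ {P Q : Set} (p? : Dec P) (q? : Dec Q) → (P → Q) → (Q → P) → ⌊ p? ⌋ ≡ ⌊ q? ⌋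
⌊⌋-⇔ p? q? to from = trans (isYes≗does p?) (trans (does-⇔ (mk⇔ to from) p? q?) (sym (isYes≗does q?)))

permTerm : ∀ {n} → Mat n → (Fin n → Fin n) → ℤ
permTerm A f = indicator ⌊ injective? f ⌋ * ∏ (λ i → A i (f i))

injective?-cong : ∀ {n} {f g : Fin n → Fin n} → f ≗ g → ⌊ injective? f ⌋ ≡ ⌊ injective? g ⌋
injective?-cong {f = f} {g} f≗g = ⌊⌋-⇔ (injective? f) (injective? g) to from
  where
  to : (∀ i j → f i ≡ f j → i ≡ j) → ∀ i j → g i ≡ g j → i ≡ j
  to inj i j gi≡gj = inj i j (trans (f≗g i) (trans gi≡gj (sym (f≗g j))))
  from : (∀ i j → g i ≡ g j → i ≡ j) → ∀ i j → f i ≡ f j → i ≡ j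
  from inj i j fi≡fj = inj i j (trans (sym (f≗g i)) (trans fi≡fj (f≗g j)))

permTerm-extensional : ∀ {n} (A : Mat n) → Extensional (permTerm A)
permTerm-extensional A f≗g =
  cong₂ _*_ (cong indicator (injective?-cong f≗g)) (Product.sum-cong-≗ (λ i → cong (A i) (f≗g i)))

per≡∑maps : ∀ {n} (A : Mat n) → per A ≡ ∑maps n n (permTerm A)
per≡∑maps {n} A =
  trans (sumℤ-filter injective? _ (allFuns n n))
  (trans (cong sumℤ (map-cong (λ f → cong (indicator ⌊ injective? f ⌋ *_) (prodℤ-allFin (λ i → A i (f i)))) (allFuns n n)))
         (sumℤ-allFuns n n (permTerm A) (permTerm-extensional A)))

per-cong : ∀ {n} {A B : Mat n} → (∀ i j → A i j ≡ B i j) → per A ≡ per B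
per-cong {n} {A} {B} A≡B = begin
  per A                      ≡⟨ per≡∑maps A ⟩
  ∑maps n n (permTerm A)     ≡⟨ ∑maps-cong n n (permTerm A) (permTerm B) (λ f → cong (indicator ⌊ injective? f ⌋ *_)
                                   (Product.sum-cong-≗ (λ i → A≡B i (f i)))) ⟩
  ∑maps n n (permTerm B)     ≡⟨ per≡∑maps B ⟨
  per B                      ∎
  where open ≡-Reasoning

per-cast : ∀ {n n′} (e : n ≡ n′) (X : Mat n′) → per X ≡ per (λ i j → X (cast e i) (cast e j))
per-cast refl X = per-cong (λ i j → sym (cong₂ X (cast-is-id refl i) (cast-is-id refl j)))

minor : ∀ {n} → Mat (suc n) → Fin (suc n) → Fin (suc n) → Mat n
minor A v x i j = A (punchIn v i) (punchIn x j)

injective?-insertAt-punchIn : ∀ {n} (v x : Fin (suc n)) (g : Fin n → Fin n) →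
  ⌊ injective? (insertAt (punchIn x ∘ g) v x) ⌋ ≡ ⌊ injective? g ⌋
injective?-insertAt-punchIn {n} v x g = ⌊⌋-⇔ (injective? G) (injective? g) to from
  where
  G : Fin (suc n) → Fin (suc n)
  G = insertAt (punchIn x ∘ g) v x
  G-v : G v ≡ x
  G-v = insertAt-lookup (punchIn x ∘ g) v x
  G-punchIn : ∀ i → G (punchIn v i) ≡ punchIn x (g i)
  G-punchIn = insertAt-punchIn (punchIn x ∘ g) v x
  to : (∀ a b → G a ≡ G b → a ≡ b) → ∀ i j → g i ≡ g j → i ≡ j
  to inj i j gi≡gj = punchIn-injective v i j
    (inj _ _ (trans (G-punchIn i) (trans (cong (punchIn x) gi≡gj) (sym (G-punchIn j)))))
  from : (∀ i j → g i ≡ g j → i ≡ j) → ∀ a b → G a ≡ G b → a ≡ b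
  from inj a b Ga≡Gb with ≡-or-punchIn v a | ≡-or-punchIn v b
  ... | inj₁ refl       | inj₁ refl       = refl
  ... | inj₁ refl       | inj₂ (j , refl) =
    ⊥-elim (punchInᵢ≢i x (g j) (sym (trans (sym G-v) (trans Ga≡Gb (G-punchIn j)))))
  ... | inj₂ (i , refl) | inj₁ refl       =
    ⊥-elim (punchInᵢ≢i x (g i) (trans (sym (G-punchIn i)) (trans Ga≡Gb G-v)))
  ... | inj₂ (i , refl) | inj₂ (j , refl) =
    cong (punchIn v) (inj i j (punchIn-injective x _ _ (trans (sym (G-punchIn i)) (trans Ga≡Gb (G-punchIn j)))))

injective?-insertAt-collision : ∀ {n} (v x : Fin (suc n)) (g : Fin n → Fin (suc n)) i →
  g i ≡ x → ⌊ injective? (insertAt g v x) ⌋ ≡ false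
injective?-insertAt-collision v x g i gi≡x =
  trans (isYes≗does (injective? (insertAt g v x))) (dec-false (injective? (insertAt g v x)) not-injective)
  where
  not-injective : ¬ (∀ a b → insertAt g v x a ≡ insertAt g v x b → a ≡ b)
  not-injective inj = punchInᵢ≢i v i (inj _ _
    (trans (insertAt-punchIn g v x i) (trans gi≡x (sym (insertAt-lookup g v x)))))

per-expandRow : ∀ {n} (A : Mat (suc n)) (v : Fin (suc n)) → per A ≡ ∑[ x < suc n ] (A v x * per (minor A v x))
per-expandRow {n} A v = begin
  per A                                                                  ≡⟨ per≡∑maps A ⟩
  ∑maps (suc n) (suc n) (permTerm A)                                     ≡⟨ ∑maps-insertAt n (suc n) v (permTerm A) (permTerm-extensional A) ⟩
  ∑[ x < suc n ] ∑maps n (suc n) (λ g → permTerm A (insertAt g v x))    ≡⟨ sum-cong-≗ expand ⟩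
  ∑[ x < suc n ] (A v x * per (minor A v x))                             ∎
  where
  open ≡-Reasoning
  rest : Fin (suc n) → (Fin n → Fin (suc n)) → ℤ
  rest x g = indicator ⌊ injective? (insertAt g v x) ⌋ * ∏ (λ i → A (punchIn v i) (g i))

  factor : ∀ x g → permTerm A (insertAt g v x) ≡ A v x * rest x g
  factor x g = begin
    indicator ⌊ injective? G ⌋ * ∏ (λ i → A i (G i))
      ≡⟨ cong (indicator ⌊ injective? G ⌋ *_) (Product.sum-remove {i = v} (λ i → A i (G i))) ⟩
    indicator ⌊ injective? G ⌋ * (A v (G v) * ∏ (λ i → A (punchIn v i) (G (punchIn v i))))
      ≡⟨ cong (λ y → indicator ⌊ injective? G ⌋ * (A v y * ∏ (λ i → A (punchIn v i) (G (punchIn v i))))) (insertAt-lookup g v x) ⟩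
    indicator ⌊ injective? G ⌋ * (A v x * ∏ (λ i → A (punchIn v i) (G (punchIn v i))))
      ≡⟨ cong (λ y → indicator ⌊ injective? G ⌋ * (A v x * y))
              (Product.sum-cong-≗ (λ i → cong (A (punchIn v i)) (insertAt-punchIn g v x i))) ⟩
    indicator ⌊ injective? G ⌋ * (A v x * ∏ (λ i → A (punchIn v i) (g i)))
      ≡⟨ swap (indicator ⌊ injective? G ⌋) (A v x) _ ⟩
    A v x * rest x g ∎
    where
    G : Fin (suc n) → Fin (suc n)
    G = insertAt g v x
    swap : ∀ a b c → a * (b * c) ≡ b * (a * c)
    swap = solve-∀

  rest-extensional : ∀ x → Extensional (rest x)
  rest-extensional x f≗g = cong₂ _*_ (cong indicator (injective?-cong (insertAt-cong v x f≗g)))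
                                     (Product.sum-cong-≗ (λ i → cong (A (punchIn v i)) (f≗g i)))

  rest-collision : ∀ x g i → g i ≡ x → rest x g ≡ 0ℤ
  rest-collision x g i gi≡x =
    trans (cong (λ b → indicator b * ∏ (λ i → A (punchIn v i) (g i))) (injective?-insertAt-collision v x g i gi≡x)) (*-zeroˡ (∏ (λ i → A (punchIn v i) (g i))))

  expand : ∀ x → ∑maps n (suc n) (λ g → permTerm A (insertAt g v x)) ≡ A v x * per (minor A v x)
  expand x = begin
    ∑maps n (suc n) (λ g → permTerm A (insertAt g v x))
      ≡⟨ ∑maps-cong n (suc n) _ (λ g → A v x * rest x g) (factor x) ⟩
    ∑maps n (suc n) (λ g → A v x * rest x g)
      ≡⟨ ∑maps-*ˡ n (suc n) (A v x) (rest x) ⟩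
    A v x * ∑maps n (suc n) (rest x)
      ≡⟨ cong (A v x *_) (∑maps-avoid n n x (rest x) (rest-extensional x) (rest-collision x)) ⟩
    A v x * ∑maps n n (λ g → rest x (punchIn x ∘ g))
      ≡⟨ cong (A v x *_) (∑maps-cong n n _ (permTerm (minor A v x))
           (λ g → cong (_* ∏ (λ i → minor A v x i (g i))) (cong indicator (injective?-insertAt-punchIn v x g)))) ⟩
    A v x * ∑maps n n (permTerm (minor A v x))
      ≡⟨ cong (A v x *_) (per≡∑maps (minor A v x)) ⟨
    A v x * per (minor A v x) ∎

-- Zero blocks and block-triangular matrices

replaceRow : ∀ {n} → Mat n → Fin n → (Fin n → ℤ) → Mat n
replaceRow X v h i j = if ⌊ i ≟ v ⌋ then h j else X i j

replaceRow-≡ : ∀ {n} (X : Mat n) v h j → replaceRow X v h v j ≡ h j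
replaceRow-≡ X v h j with v ≟ v
... | yes _   = refl
... | no v≢v = ⊥-elim (v≢v refl)

replaceRow-≢ : ∀ {n} (X : Mat n) v h {i} j → i ≢ v → replaceRow X v h i j ≡ X i j
replaceRow-≢ X v h {i} j i≢v with i ≟ v
... | yes i≡v = ⊥-elim (i≢v i≡v)
... | no _    = refl

replaceRow-vanish : ∀ {n} (X : Mat n) v h i j → (i ≡ v → h j ≡ 0ℤ) → (i ≢ v → X i j ≡ 0ℤ) →
  replaceRow X v h i j ≡ 0ℤ
replaceRow-vanish X v h i j h≡0 X≡0 with i ≟ v
... | yes i≡v = h≡0 i≡v
... | no i≢v  = X≡0 i≢v

per-replaceRow : ∀ {n} (X : Mat (suc n)) v h → per (replaceRow X v h) ≡ ∑[ x < suc n ] (h x * per (minor X v x))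
per-replaceRow X v h = trans (per-expandRow (replaceRow X v h) v) (sum-cong-≗ λ x →
  cong₂ _*_ (replaceRow-≡ X v h x) (per-cong (λ i j → replaceRow-≢ X v h (punchIn x j) (punchInᵢ≢i v i))))

dropAt : ∀ {n} → Fin n → (Fin n → ℤ) → Fin n → ℤ
dropAt c h j = if ⌊ j ≟ c ⌋ then 0ℤ else h j

dropAt-≡ : ∀ {n} (c : Fin n) h → dropAt c h c ≡ 0ℤ
dropAt-≡ c h with c ≟ c
... | yes _   = refl
... | no c≢c = ⊥-elim (c≢c refl)

dropAt-≢ : ∀ {n} (c : Fin n) h {j} → j ≢ c → dropAt c h j ≡ h j
dropAt-≢ c h {j} j≢c with j ≟ c
... | yes j≡c = ⊥-elim (j≢c j≡c)
... | no _    = refl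

dropAt-vanish : ∀ {n} (c : Fin n) h j → (j ≢ c → h j ≡ 0ℤ) → dropAt c h j ≡ 0ℤ
dropAt-vanish c h j vanish with j ≟ c
... | yes _   = refl
... | no j≢c = vanish j≢c

per-isolateEntry : ∀ {n} (X : Mat (suc n)) v c →
  per X ≡ per (replaceRow X v (dropAt c (X v))) + X v c * per (minor X v c)
per-isolateEntry {n} X v c = begin
  per X
    ≡⟨ per-expandRow X v ⟩
  ∑[ x < suc n ] (X v x * m x)
    ≡⟨ sum-remove {i = c} (λ x → X v x * m x) ⟩
  X v c * m c + ∑[ i < n ] (X v (punchIn c i) * m (punchIn c i))
    ≡⟨ +-comm (X v c * m c) _ ⟩
  ∑[ i < n ] (X v (punchIn c i) * m (punchIn c i)) + X v c * m c
    ≡⟨ cong (_+ X v c * m c) dropped ⟨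
  per (replaceRow X v (dropAt c (X v))) + X v c * m c ∎
  where
  open ≡-Reasoning
  m : Fin (suc n) → ℤ
  m x = per (minor X v x)
  dropped : per (replaceRow X v (dropAt c (X v))) ≡ ∑[ i < n ] (X v (punchIn c i) * m (punchIn c i))
  dropped = begin
    per (replaceRow X v (dropAt c (X v)))
      ≡⟨ per-replaceRow X v (dropAt c (X v)) ⟩
    ∑[ x < suc n ] (dropAt c (X v) x * m x)
      ≡⟨ sum-remove {i = c} (λ x → dropAt c (X v) x * m x) ⟩
    dropAt c (X v) c * m c + ∑[ i < n ] (dropAt c (X v) (punchIn c i) * m (punchIn c i))
      ≡⟨ cong₂ _+_ (trans (cong (_* m c) (dropAt-≡ c (X v))) (*-zeroˡ (m c)))
                   (sum-cong-≗ (λ i → cong (_* m (punchIn c i)) (dropAt-≢ c (X v) (punchInᵢ≢i c i)))) ⟩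
    0ℤ + ∑[ i < n ] (X v (punchIn c i) * m (punchIn c i))
      ≡⟨ +-identityˡ _ ⟩
    ∑[ i < n ] (X v (punchIn c i) * m (punchIn c i)) ∎

per-zeroColumn : ∀ {n} (X : Mat n) c → (∀ i → X i c ≡ 0ℤ) → per X ≡ 0ℤ
per-zeroColumn {suc n} X c column≡0 = trans (per-expandRow X zero) (∑-zero _ term≡0)
  where
  term≡0 : ∀ x → X zero x * per (minor X zero x) ≡ 0ℤ
  term≡0 x with x ≟ c
  ... | yes refl = trans (cong (_* per (minor X zero x)) (column≡0 zero)) (*-zeroˡ (per (minor X zero x)))
  ... | no x≢c   = trans (cong (X zero x *_) (per-zeroColumn (minor X zero x) (punchOut x≢c)
                     (λ i → trans (cong (X (suc i)) (punchIn-punchOut x≢c)) (column≡0 (suc i)))))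
                   (*-zeroʳ (X zero x))

-- Rows p … n-1 are supported in the n - p - 1 columns after p, so no permutation avoids the zero block.
per-zeroBlock : ∀ {n} (X : Mat n) p → p ℕ.< n → (∀ i j → p ℕ.≤ toℕ i → toℕ j ℕ.≤ p → X i j ≡ 0ℤ) → per X ≡ 0ℤ
per-zeroBlock {suc n} X zero _ block≡0 = per-zeroColumn X zero (λ i → block≡0 i zero ℕ.z≤n ℕ.z≤n)
per-zeroBlock {suc n} X (suc p) (ℕ.s≤s p<n) block≡0 = trans (per-expandRow X zero) (∑-zero _ λ x →
  trans (cong (X zero x *_) (per-zeroBlock (minor X zero x) p p<n
          (λ i j p≤i j≤p → block≡0 (suc i) (punchIn x j) (ℕ.s≤s p≤i) (NP.≤-trans (toℕ-punchIn≤ x j) (ℕ.s≤s j≤p)))))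
        (*-zeroʳ (X zero x)))

topLeft : ∀ p q → Mat (p ℕ.+ q) → Mat p
topLeft p q X i j = X (i ↑ˡ q) (j ↑ˡ q)

bottomRight : ∀ p q → Mat (p ℕ.+ q) → Mat q
bottomRight p q X i j = X (p ↑ʳ i) (p ↑ʳ j)

per-blockTriangular : ∀ p q (X : Mat (p ℕ.+ q)) → (∀ x y → X (x ↑ˡ q) (p ↑ʳ y) ≡ 0ℤ) →
  per X ≡ per (topLeft p q X) * per (bottomRight p q X)
per-blockTriangular zero    q X _       = sym (*-identityˡ (per X))
per-blockTriangular (suc p) q X upper≡0 = begin
  per X
    ≡⟨ per-expandRow X zero ⟩
  ∑[ x < suc p ℕ.+ q ] term x
    ≡⟨ ∑-↑ (suc p) q term ⟩
  ∑[ y < suc p ] term (y ↑ˡ q) + ∑[ z < q ] term (suc p ↑ʳ z)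
    ≡⟨ cong (∑[ y < suc p ] term (y ↑ˡ q) +_) (∑-zero (λ z → term (suc p ↑ʳ z))
         (λ z → trans (cong (_* per (minor X zero (suc p ↑ʳ z))) (upper≡0 zero z)) (*-zeroˡ (per (minor X zero (suc p ↑ʳ z)))))) ⟩
  ∑[ y < suc p ] term (y ↑ˡ q) + 0ℤ
    ≡⟨ +-identityʳ _ ⟩
  ∑[ y < suc p ] term (y ↑ˡ q)
    ≡⟨ sum-cong-≗ left-term ⟩
  ∑[ y < suc p ] (TL zero y * per (minor TL zero y) * per BR)
    ≡⟨ *-distribʳ-sum (per BR) (λ y → TL zero y * per (minor TL zero y)) ⟨
  ∑[ y < suc p ] (TL zero y * per (minor TL zero y)) * per BR
    ≡⟨ cong (_* per BR) (per-expandRow TL zero) ⟨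
  per TL * per BR ∎
  where
  open ≡-Reasoning
  TL : Mat (suc p)
  TL = topLeft (suc p) q X
  BR : Mat q
  BR = bottomRight (suc p) q X
  term : Fin (suc p ℕ.+ q) → ℤ
  term x = X zero x * per (minor X zero x)
  minor-blocks : ∀ y → per (minor X zero (y ↑ˡ q)) ≡ per (minor TL zero y) * per BR
  minor-blocks y = trans
    (per-blockTriangular p q (minor X zero (y ↑ˡ q))
      (λ x z → trans (cong (X (suc (x ↑ˡ q))) (punchIn-↑ʳ q y z)) (upper≡0 (suc x) z)))
    (cong₂ _*_ (per-cong (λ i j → cong (X (suc (i ↑ˡ q))) (punchIn-↑ˡ q y j)))
               (per-cong (λ i j → cong (X (suc (p ↑ʳ i))) (punchIn-↑ʳ q y j))))
  left-term : ∀ y → term (y ↑ˡ q) ≡ TL zero y * per (minor TL zero y) * per BR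
  left-term y = trans (cong (TL zero y *_) (minor-blocks y)) (sym (*-assoc (TL zero y) _ _))

-- Gluing two matrices along one entry

linkWeight-off : ∀ {a m} (v x : Fin a) (r y : Fin m) (s : ℤ) → ¬ (x ≡ v × y ≡ r) →
  (if ⌊ x ≟ v ⌋ ∧ ⌊ y ≟ r ⌋ then s else 0ℤ) ≡ 0ℤ
linkWeight-off v x r y s off with x ≟ v | y ≟ r
... | yes x≡v | yes y≡r = ⊥-elim (off (x≡v , y≡r))
... | yes _   | no _    = refl
... | no _    | _       = refl

linkWeight-on : ∀ {a m} (v : Fin a) (r : Fin m) (s : ℤ) → (if ⌊ v ≟ v ⌋ ∧ ⌊ r ≟ r ⌋ then s else 0ℤ) ≡ s
linkWeight-on v r s with v ≟ v | r ≟ r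
... | yes _ | yes _ = refl
... | no v≢v | _    = ⊥-elim (v≢v refl)
... | yes _ | no r≢r = ⊥-elim (r≢r refl)

module Glue {a m} (G : Mat a) (v : Fin a) (T : Mat m) (r : Fin m) (s : ℤ) where

  M : Mat (a ℕ.+ m)
  M = glue G v T r s

  M-↑ˡ-↑ˡ : ∀ x y → M (x ↑ˡ m) (y ↑ˡ m) ≡ G x y
  M-↑ˡ-↑ˡ x y rewrite splitAt-↑ˡ a x m | splitAt-↑ˡ a y m = refl

  M-↑ʳ-↑ʳ : ∀ x y → M (a ↑ʳ x) (a ↑ʳ y) ≡ T x y
  M-↑ʳ-↑ʳ x y rewrite splitAt-↑ʳ a m x | splitAt-↑ʳ a m y = refl

  M-↑ˡ-↑ʳ : ∀ x y → ¬ (x ≡ v × y ≡ r) → M (x ↑ˡ m) (a ↑ʳ y) ≡ 0ℤ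
  M-↑ˡ-↑ʳ x y off rewrite splitAt-↑ˡ a x m | splitAt-↑ʳ a m y = linkWeight-off v x r y s off

  M-↑ʳ-↑ˡ : ∀ x y → ¬ (y ≡ v × x ≡ r) → M (a ↑ʳ x) (y ↑ˡ m) ≡ 0ℤ
  M-↑ʳ-↑ˡ x y off rewrite splitAt-↑ˡ a y m | splitAt-↑ʳ a m x = linkWeight-off v y r x s off

  M-link : M (v ↑ˡ m) (a ↑ʳ r) ≡ s
  M-link rewrite splitAt-↑ˡ a v m | splitAt-↑ʳ a m r = linkWeight-on v r s

  M-link′ : M (a ↑ʳ r) (v ↑ˡ m) ≡ s
  M-link′ rewrite splitAt-↑ˡ a v m | splitAt-↑ʳ a m r = linkWeight-on v r s

per-deleteVertex-glue : ∀ {a′ m} (G : Mat (suc a′)) (v : Fin (suc a′)) (T : Mat m) (r : Fin m) (s : ℤ) →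
  per (deleteVertex (v ↑ˡ m) (glue G v T r s)) ≡ per (deleteVertex v G) * per T
per-deleteVertex-glue {a′} {m} G v T r s =
  trans (per-blockTriangular a′ m (deleteVertex (v ↑ˡ m) M) upper≡0)
        (cong₂ _*_ (per-cong (λ i j → trans (cong₂ M (punchIn-↑ˡ m v i) (punchIn-↑ˡ m v j)) (M-↑ˡ-↑ˡ (punchIn v i) (punchIn v j))))
                   (per-cong (λ i j → trans (cong₂ M (punchIn-↑ʳ m v i) (punchIn-↑ʳ m v j)) (M-↑ʳ-↑ʳ i j))))
  where
  open Glue G v T r s
  upper≡0 : ∀ x y → deleteVertex (v ↑ˡ m) M (x ↑ˡ m) (a′ ↑ʳ y) ≡ 0ℤ
  upper≡0 x y = trans (cong₂ M (punchIn-↑ˡ m v x) (punchIn-↑ʳ m v y))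
                      (M-↑ˡ-↑ʳ (punchIn v x) y (punchInᵢ≢i v x ∘ proj₁))

module GlueLink {a′ m′} (G : Mat (suc a′)) (v : Fin (suc a′)) (T : Mat (suc m′)) (r : Fin (suc m′)) (s : ℤ) where
  open Glue G v T r s public

  a m : ℕ
  a = suc a′
  m = suc m′

  V R : Fin (a ℕ.+ m)
  V = v ↑ˡ m
  R = a ↑ʳ r

  per-unlinked : per (replaceRow M V (dropAt R (M V))) ≡ per G * per T
  per-unlinked = trans (per-blockTriangular a m (replaceRow M V (dropAt R (M V))) upper≡0)
                       (cong₂ _*_ (per-cong top-left) (per-cong bottom-right))
    where
    upper≡0 : ∀ x y → replaceRow M V (dropAt R (M V)) (x ↑ˡ m) (a ↑ʳ y) ≡ 0ℤ
    upper≡0 x y = replaceRow-vanish M V (dropAt R (M V)) (x ↑ˡ m) (a ↑ʳ y)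
      (λ _ → dropAt-vanish R (M V) (a ↑ʳ y) λ y↑≢R → M-↑ˡ-↑ʳ v y λ (_ , y≡r) → y↑≢R (cong (a ↑ʳ_) y≡r))
      (λ x↑≢V → M-↑ˡ-↑ʳ x y λ (x≡v , _) → x↑≢V (cong (_↑ˡ m) x≡v))
    top-left : ∀ x y → replaceRow M V (dropAt R (M V)) (x ↑ˡ m) (y ↑ˡ m) ≡ G x y
    top-left x y with x ≟ v
    ... | no x≢v   = trans (replaceRow-≢ M V (dropAt R (M V)) (y ↑ˡ m) (x≢v ∘ ↑ˡ-injective m x v)) (M-↑ˡ-↑ˡ x y)
    ... | yes refl = trans (replaceRow-≡ M V (dropAt R (M V)) (y ↑ˡ m)) (trans (dropAt-≢ R (M V) (↑ˡ≢↑ʳ y r)) (M-↑ˡ-↑ˡ v y))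
    bottom-right : ∀ x y → replaceRow M V (dropAt R (M V)) (a ↑ʳ x) (a ↑ʳ y) ≡ T x y
    bottom-right x y = trans (replaceRow-≢ M V (dropAt R (M V)) (a ↑ʳ y) (↑ˡ≢↑ʳ v x ∘ sym)) (M-↑ʳ-↑ʳ x y)

  -- minor M V R lives on Fin (a′ + m), not syntactically a successor; K is the same matrix on
  -- Fin (suc (a′ + m′)), so that it can be expanded along the row ρ of the root r.
  e : suc (a′ ℕ.+ m′) ≡ a′ ℕ.+ m
  e = sym (NP.+-suc a′ m′)

  row col : Fin (suc (a′ ℕ.+ m′)) → Fin (a ℕ.+ m)
  row i = punchIn V (cast e i)
  col j = punchIn R (cast e j)

  K : Mat (suc (a′ ℕ.+ m′))
  K i j = M (row i) (col j)

  ρ γ : Fin (suc (a′ ℕ.+ m′))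
  ρ = cast (sym e) (a′ ↑ʳ r)
  γ = v ↑ˡ m′

  v≤a′ : toℕ v ℕ.≤ a′
  v≤a′ = NP.≤-pred (toℕ<n v)

  toℕ-ρ : toℕ ρ ≡ a′ ℕ.+ toℕ r
  toℕ-ρ = trans (toℕ-cast (sym e) (a′ ↑ʳ r)) (toℕ-↑ʳ a′ r)

  toℕ-row : ∀ i → a′ ℕ.≤ toℕ i → toℕ (row i) ≡ suc (toℕ i)
  toℕ-row i a′≤i = trans
    (toℕ-punchIn-≥ V (cast e i) (subst₂ ℕ._≤_ (sym (toℕ-↑ˡ v m)) (sym (toℕ-cast e i)) (NP.≤-trans v≤a′ a′≤i)))
    (cong suc (toℕ-cast e i))

  toℕ-col : ∀ j → toℕ j ℕ.≤ a′ → toℕ (col j) ≡ toℕ j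
  toℕ-col j j≤a′ = trans
    (toℕ-punchIn-< R (cast e j) (subst₂ ℕ._<_ (sym (toℕ-cast e j)) (sym (toℕ-↑ʳ a r))
                                        (ℕ.s≤s (NP.≤-trans j≤a′ (NP.m≤m+n a′ (toℕ r))))))
    (toℕ-cast e j)

  row-ρ : row ρ ≡ R
  row-ρ = toℕ-injective (trans (toℕ-row ρ (subst (a′ ℕ.≤_) (sym toℕ-ρ) (NP.m≤m+n a′ (toℕ r))))
                               (trans (cong suc toℕ-ρ) (sym (toℕ-↑ʳ a r))))

  col-γ : col γ ≡ V
  col-γ = toℕ-injective (trans (toℕ-col γ (subst (ℕ._≤ a′) (sym (toℕ-↑ˡ v m′)) v≤a′))
                               (trans (toℕ-↑ˡ v m′) (sym (toℕ-↑ˡ v m))))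

  row-injective : ∀ {i j} → row i ≡ row j → i ≡ j
  row-injective eq = cast-injective e (punchIn-injective V _ _ eq)

  col-injective : ∀ {i j} → col i ≡ col j → i ≡ j
  col-injective eq = cast-injective e (punchIn-injective R _ _ eq)

  per-K-unlinked : per (replaceRow K ρ (dropAt γ (K ρ))) ≡ 0ℤ
  per-K-unlinked = per-zeroBlock (replaceRow K ρ (dropAt γ (K ρ))) a′ (ℕ.s≤s (NP.m≤m+n a′ m′)) block≡0
    where
    block≡0 : ∀ i j → a′ ℕ.≤ toℕ i → toℕ j ℕ.≤ a′ → replaceRow K ρ (dropAt γ (K ρ)) i j ≡ 0ℤ
    block≡0 i j a′≤i j≤a′ = replaceRow-vanish K ρ (dropAt γ (K ρ)) i j
      (λ _ → dropAt-vanish γ (K ρ) j λ j≢γ → trans (cong₂ M row-ρ (sym y↑≡col))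
        (M-↑ʳ-↑ˡ r y λ (y≡v , _) → j≢γ (col-injective (trans (sym y↑≡col) (trans (cong (_↑ˡ m) y≡v) (sym col-γ))))))
      (λ i≢ρ → trans (cong₂ M (sym x↑≡row) (sym y↑≡col))
        (M-↑ʳ-↑ˡ x y λ (_ , x≡r) → i≢ρ (row-injective (trans (sym x↑≡row) (trans (cong (a ↑ʳ_) x≡r) (sym row-ρ))))))
      where
      y↑ : Σ (Fin a) (λ y → y ↑ˡ m ≡ col j)
      y↑ = ↑ˡ-of-< a m (col j) (subst (ℕ._< a) (sym (toℕ-col j j≤a′)) (ℕ.s≤s j≤a′))
      y : Fin a
      y = proj₁ y↑
      y↑≡col : y ↑ˡ m ≡ col j
      y↑≡col = proj₂ y↑
      x↑ : Σ (Fin m) (λ x → a ↑ʳ x ≡ row i)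
      x↑ = ↑ʳ-of-≥ a m (row i) (subst (a ℕ.≤_) (sym (toℕ-row i a′≤i)) (ℕ.s≤s a′≤i))
      x : Fin m
      x = proj₁ x↑
      x↑≡row : a ↑ʳ x ≡ row i
      x↑≡row = proj₂ x↑

  row-punchIn-↑ˡ : ∀ x → row (punchIn ρ (x ↑ˡ m′)) ≡ punchIn v x ↑ˡ m
  row-punchIn-↑ˡ x = toℕ-injective (trans
    (toℕ-punchIn-shift 0 v x V (cast e (punchIn ρ (x ↑ˡ m′))) (toℕ-↑ˡ v m)
      (trans (toℕ-cast e _) (trans (toℕ-punchIn-< ρ (x ↑ˡ m′) x<ρ) (toℕ-↑ˡ x m′))))
    (sym (toℕ-↑ˡ (punchIn v x) m)))
    where
    x<ρ : toℕ (x ↑ˡ m′) ℕ.< toℕ ρ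
    x<ρ = subst₂ ℕ._<_ (sym (toℕ-↑ˡ x m′)) (sym toℕ-ρ) (NP.<-≤-trans (toℕ<n x) (NP.m≤m+n a′ (toℕ r)))

  row-punchIn-↑ʳ : ∀ y → row (punchIn ρ (a′ ↑ʳ y)) ≡ a ↑ʳ punchIn r y
  row-punchIn-↑ʳ y = toℕ-injective (trans
    (toℕ-row _ (subst (a′ ℕ.≤_) (sym toℕ-punchIn) (NP.m≤m+n a′ _)))
    (trans (cong suc toℕ-punchIn) (sym (toℕ-↑ʳ a (punchIn r y)))))
    where
    toℕ-punchIn : toℕ (punchIn ρ (a′ ↑ʳ y)) ≡ a′ ℕ.+ toℕ (punchIn r y)
    toℕ-punchIn = toℕ-punchIn-shift a′ r y ρ (a′ ↑ʳ y) toℕ-ρ (toℕ-↑ʳ a′ y)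

  col-punchIn-↑ˡ : ∀ x → col (punchIn γ (x ↑ˡ m′)) ≡ punchIn v x ↑ˡ m
  col-punchIn-↑ˡ x = trans (cong col (punchIn-↑ˡ m′ v x)) (toℕ-injective (trans
    (toℕ-col _ (subst (ℕ._≤ a′) (sym (toℕ-↑ˡ (punchIn v x) m′)) (NP.≤-pred (toℕ<n (punchIn v x)))))
    (trans (toℕ-↑ˡ (punchIn v x) m′) (sym (toℕ-↑ˡ (punchIn v x) m)))))

  col-punchIn-↑ʳ : ∀ y → col (punchIn γ (a′ ↑ʳ y)) ≡ a ↑ʳ punchIn r y
  col-punchIn-↑ʳ y = trans (cong col (punchIn-↑ʳ m′ v y)) (toℕ-injective (trans
    (toℕ-punchIn-shift a r y R (cast e (a ↑ʳ y)) (toℕ-↑ʳ a r) (trans (toℕ-cast e (a ↑ʳ y)) (toℕ-↑ʳ a y)))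
    (sym (toℕ-↑ʳ a (punchIn r y)))))

  per-minor-K : per (minor K ρ γ) ≡ per (deleteVertex v G) * per (deleteVertex r T)
  per-minor-K = trans (per-blockTriangular a′ m′ (minor K ρ γ) upper≡0)
    (cong₂ _*_ (per-cong λ i j → trans (cong₂ M (row-punchIn-↑ˡ i) (col-punchIn-↑ˡ j)) (M-↑ˡ-↑ˡ (punchIn v i) (punchIn v j)))
               (per-cong λ i j → trans (cong₂ M (row-punchIn-↑ʳ i) (col-punchIn-↑ʳ j)) (M-↑ʳ-↑ʳ (punchIn r i) (punchIn r j))))
    where
    upper≡0 : ∀ x y → minor K ρ γ (x ↑ˡ m′) (a′ ↑ʳ y) ≡ 0ℤ
    upper≡0 x y = trans (cong₂ M (row-punchIn-↑ˡ x) (col-punchIn-↑ʳ y))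
                        (M-↑ˡ-↑ʳ (punchIn v x) (punchIn r y) (punchInᵢ≢i v x ∘ proj₁))

  per-minor-link : per (minor M V R) ≡ s * (per (deleteVertex v G) * per (deleteVertex r T))
  per-minor-link = begin
    per (minor M V R)                                              ≡⟨ per-cast e (minor M V R) ⟩
    per K                                                          ≡⟨ per-isolateEntry K ρ γ ⟩
    per (replaceRow K ρ (dropAt γ (K ρ))) + K ρ γ * per (minor K ρ γ)
                                                                   ≡⟨ cong₂ _+_ per-K-unlinked (cong₂ _*_ K-ργ per-minor-K) ⟩
    0ℤ + s * (per (deleteVertex v G) * per (deleteVertex r T))    ≡⟨ +-identityˡ _ ⟩
    s * (per (deleteVertex v G) * per (deleteVertex r T))         ∎
    where
    open ≡-Reasoning
    K-ργ : K ρ γ ≡ s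
    K-ργ = trans (cong₂ M row-ρ col-γ) M-link′

per-glue : ∀ {a m} (G : Mat a) (v : Fin a) (T : Mat m) (r : Fin m) (s : ℤ) →
  per (glue G v T r s) ≡ per G * per T + s * (s * (per (deleteVertex v G) * per (deleteVertex r T)))
per-glue {suc a′} {suc m′} G v T r s = begin
  per M                                                              ≡⟨ per-isolateEntry M V R ⟩
  per (replaceRow M V (dropAt R (M V))) + M V R * per (minor M V R)  ≡⟨ cong₂ _+_ per-unlinked (cong₂ _*_ M-link per-minor-link) ⟩
  per G * per T + s * (s * (per (deleteVertex v G) * per (deleteVertex r T))) ∎
  where
  open ≡-Reasoning
  open GlueLink G v T r s

-- Pendant trees

filter-≢-map-suc : ∀ {k} (i : Fin k) (xs : List (Fin k)) →
  filter (λ j → ¬? (j ≟ suc i)) (map suc xs) ≡ map suc (filter (λ j → ¬? (j ≟ i)) xs)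
filter-≢-map-suc i []       = refl
filter-≢-map-suc i (x ∷ xs) with does (x ≟ i)
... | true  = filter-≢-map-suc i xs
... | false = cong (suc x ∷_) (filter-≢-map-suc i xs)

filter-≢-allFin : ∀ {k} (i : Fin (suc k)) → filter (λ j → ¬? (j ≟ i)) (allFin (suc k)) ≡ tabulate (punchIn i)
filter-≢-allFin zero = filter-all (λ j → ¬? (j ≟ zero)) (tabulate⁺ (λ j → λ ()))
filter-≢-allFin {suc k} (suc i) = cong (zero ∷_) (begin
  filter (λ j → ¬? (j ≟ suc i)) (tabulate suc)           ≡⟨ cong (filter (λ j → ¬? (j ≟ suc i))) (map-tabulate (λ j → j) suc) ⟨
  filter (λ j → ¬? (j ≟ suc i)) (map suc (allFin (suc k))) ≡⟨ filter-≢-map-suc i (allFin (suc k)) ⟩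
  map suc (filter (λ j → ¬? (j ≟ i)) (allFin (suc k)))     ≡⟨ cong (map suc) (filter-≢-allFin i) ⟩
  map suc (tabulate (punchIn i))                            ≡⟨ map-tabulate (punchIn i) suc ⟩
  tabulate (suc ∘ punchIn i)                                ∎)
  where open ≡-Reasoning

prodℤ-omit : ∀ {k} (p : Fin (suc k) → ℤ) (i : Fin (suc k)) →
  prodℤ (map p (filter (λ j → ¬? (j ≟ i)) (allFin (suc k)))) ≡ ∏ (p ∘ punchIn i)
prodℤ-omit p i = trans (cong (prodℤ ∘ map p) (filter-≢-allFin i))
                       (trans (cong prodℤ (map-tabulate (punchIn i) p)) (prodℤ-tabulate (p ∘ punchIn i)))

prodℤ-lookup : ∀ {A : Set} (f : A → ℤ) (xs : List A) → prodℤ (map f xs) ≡ ∏ (f ∘ lookup xs)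
prodℤ-lookup f []       = refl
prodℤ-lookup f (x ∷ xs) = cong (f x *_) (prodℤ-lookup f xs)

perTrees : List PendantTree → ℤ
perTrees ts = prodℤ (map (λ t → per (adj t)) ts)

mixedSum≡∑ : ∀ t ts → mixedSum (t ∷ ts) ≡
  ∑[ i < suc (length ts) ] (per (withV (lookup (t ∷ ts) i)) * ∏ (λ j → per (adj (lookup (t ∷ ts) (punchIn i j)))))
mixedSum≡∑ t ts = trans (sumℤ-allFin term) (sum-cong-≗ λ i →
  cong (per (withV (lookup (t ∷ ts) i)) *_) (prodℤ-omit (λ j → per (adj (lookup (t ∷ ts) j))) i))
  where
  term : Fin (suc (length ts)) → ℤ
  term i = per (withV (lookup (t ∷ ts) i)) *
           prodℤ (map (λ j → per (adj (lookup (t ∷ ts) j))) (filter (λ j → ¬? (j ≟ i)) (allFin (suc (length ts)))))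

mixedSum-cons : ∀ t ts → mixedSum (t ∷ ts) ≡ per (withV t) * perTrees ts + per (adj t) * mixedSum ts
mixedSum-cons t [] = trans (mixedSum≡∑ t []) (cong (per (withV t) * 1ℤ +_) (sym (*-zeroʳ (per (adj t)))))
mixedSum-cons t (t′ ∷ ts) = begin
  mixedSum (t ∷ t′ ∷ ts)
    ≡⟨ mixedSum≡∑ t (t′ ∷ ts) ⟩
  W zero * ∏ (P ∘ suc) + ∑[ i < suc (length ts) ] (W (suc i) * (P zero * ∏ (P ∘ suc ∘ punchIn i)))
    ≡⟨ cong₂ _+_ (cong (W zero *_) (sym (prodℤ-lookup (λ t → per (adj t)) (t′ ∷ ts))))
                 (sum-cong-≗ λ i → swap (W (suc i)) (P zero) (∏ (P ∘ suc ∘ punchIn i))) ⟩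
  per (withV t) * perTrees (t′ ∷ ts) + ∑[ i < suc (length ts) ] (P zero * (W (suc i) * ∏ (P ∘ suc ∘ punchIn i)))
    ≡⟨ cong (per (withV t) * perTrees (t′ ∷ ts) +_)
            (trans (sym (*-distribˡ-sum (P zero) (λ i → W (suc i) * ∏ (P ∘ suc ∘ punchIn i))))
                   (cong (P zero *_) (sym (mixedSum≡∑ t′ ts)))) ⟩
  per (withV t) * perTrees (t′ ∷ ts) + per (adj t) * mixedSum (t′ ∷ ts) ∎
  where
  open ≡-Reasoning
  W P : Fin (suc (suc (length ts))) → ℤ
  W i = per (withV (lookup (t ∷ t′ ∷ ts) i))
  P i = per (adj (lookup (t ∷ t′ ∷ ts) i))
  swap : ∀ x y z → x * (y * z) ≡ y * (x * z)
  swap = solve-∀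

signℤ-*-signℤ : ∀ σ x → signℤ σ * (signℤ σ * x) ≡ x
signℤ-*-signℤ Sign.+ x = trans (*-identityˡ _) (*-identityˡ x)
signℤ-*-signℤ Sign.- x = trans (sym (*-assoc -1ℤ -1ℤ x)) (*-identityˡ x)

per-withV : ∀ t → per (withV t) ≡ per (deleteVertex (root t) (adj t))
per-withV t = begin
  per (withV t)                  ≡⟨ per-glue {1} (λ _ _ → 0ℤ) zero (adj t) (root t) (signℤ (link t)) ⟩
  0ℤ * per (adj t) + signℤ (link t) * (signℤ (link t) * (1ℤ * D))
                                 ≡⟨ cong₂ _+_ (*-zeroˡ (per (adj t))) (signℤ-*-signℤ (link t) (1ℤ * D)) ⟩
  0ℤ + 1ℤ * D                    ≡⟨ trans (+-identityˡ _) (*-identityˡ D) ⟩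
  D                              ∎
  where
  open ≡-Reasoning
  D : ℤ
  D = per (deleteVertex (root t) (adj t))

per-glueT : ∀ {a} (G : Mat a) (v : Fin a) t →
  per (glueT G v t) ≡ per G * per (adj t) + per (deleteVertex v G) * per (withV t)
per-glueT G v t = trans (per-glue G v (adj t) (root t) (signℤ (link t)))
  (cong (per G * per (adj t) +_) (trans (signℤ-*-signℤ (link t) _) (cong (per (deleteVertex v G) *_) (sym (per-withV t)))))

per-glueAll : ∀ {a} (G : Mat a) (v : Fin a) ts →
  per (glueAll G v ts) ≡ per G * perTrees ts + per (deleteVertex v G) * mixedSum ts
per-glueAll G v [] = no-trees (per G) (per (deleteVertex v G))
  where
  no-trees : ∀ g d → g ≡ g * 1ℤ + d * 0ℤ
  no-trees = solve-∀
per-glueAll {suc a′} G v (t ∷ ts) = begin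
  per (glueAll (glueT G v t) (v ↑ˡ size t) ts)
    ≡⟨ per-glueAll (glueT G v t) (v ↑ˡ size t) ts ⟩
  per (glueT G v t) * perTrees ts + per (deleteVertex (v ↑ˡ size t) (glueT G v t)) * mixedSum ts
    ≡⟨ cong₂ (λ x y → x * perTrees ts + y * mixedSum ts)
             (per-glueT G v t) (per-deleteVertex-glue G v (adj t) (root t) (signℤ (link t))) ⟩
  (g * pT + d * w) * perTrees ts + d * pT * mixedSum ts
    ≡⟨ regroup g pT d w (perTrees ts) (mixedSum ts) ⟩
  g * (pT * perTrees ts) + d * (w * perTrees ts + pT * mixedSum ts)
    ≡⟨ cong (λ x → g * (pT * perTrees ts) + d * x) (mixedSum-cons t ts) ⟨
  g * perTrees (t ∷ ts) + d * mixedSum (t ∷ ts) ∎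
  where
  open ≡-Reasoning
  g d pT w : ℤ
  g = per G
  d = per (deleteVertex v G)
  pT = per (adj t)
  w = per (withV t)
  regroup : ∀ g pT d w P mix → (g * pT + d * w) * P + d * pT * mix ≡ g * (pT * P) + d * (w * P + pT * mix)
  regroup = solve-∀

corollary3 : (n : ℕ) → 3 ≤ n → (w : Fin n → Sign) → (v : Fin n) → (ts : List PendantTree) →
    per (unicyclic n w v ts)
      ≡ per (cycleMat n w) * prodℤ (map (λ t → per (adj t)) ts)
        + per (deleteVertex v (cycleMat n w)) * mixedSum ts
corollary3 n _ w v ts = per-glueAll (cycleMat n w) v ts
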